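{- Let $T$ be a tree with at least two leaves all of whose non-leaf vertices have degree $3$, and let $G$ and $H$ be similar alt-path structures of $T$. Let $\varphi$ be the natural bijection from the degree-$1$ vertices of $G$ to those of $H$ (mapping the vertex $x_i$ of the gadget of a leaf $\ell$ of $T$ in $G$ to the vertex $x_i$ of the gadget of $\ell$ in $H$). Then for all degree-$1$ vertices $x,y$ of $G$, the shortest-path distance between $x$ and $y$ in $G$ equals the shortest-path distance between $\varphi(x)$ and $\varphi(y)$ in $H$; i.e. similar alt-path structures realize the same shortest distance matrix.
   Context: Graphs are unweighted; distances count edges. Alt-path structures: let $T$ be as in the claim, fix a proper $2$-colouring of its vertices with colours black and red, and for each leaf $\ell$ fix $k_\ell\in\{2,3\}$. Replace vertices of $T$ by gadgets, keeping every edge of $T$ but reattaching each replaced endpoint to the attachment vertex of its gadget: (1) each black internal vertex $v$ with neighbours $u_1,u_2,u_3$ is replaced by new vertices $v_1,v_2,v_3,n_v,s_v$ with edges $n_vv_i,s_vv_i$ ($i=1,2,3$), the edge to $u_i$ attached to $v_i$; (2) each black leaf $\ell$ ($k=k_\ell$) is replaced by new vertices $w,p,q,c_1,\dots,c_k$ and new degree-$1$ vertices $x_1,\dots,x_k$ with edges $wp,wq,pq,pc_1,c_1c_2,\dots,c_{k-1}c_k,c_kq$ and $c_ix_i$, the edge at $\ell$ attached to $w$; (3) each red leaf $\ell$ ($k=k_\ell$) is replaced by new vertices $w,c_1,\dots,c_k$ and new degree-$1$ vertices $x_1,\dots,x_k$ with edges $wc_1,c_1c_2,\dots,c_{k-1}c_k,c_kw$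 and $c_ix_i$, the edge at $\ell$ attached to $w$; red internal vertices are unchanged. The result is an alt-path structure of $T$. The similar alt-path structure is the one obtained from the same $T$ with the same values $k_\ell$ but with the two colours swapped. -}

module Defs where

open import Data.Nat using (ℕ; zero; suc; _+_; _≤_; _<_)
open import Data.Fin using (Fin)
open import Data.Bool using (Bool; true; false; if_then_else_)
open import Data.List using (List; []; _∷_; _++_; map; length; allFin)
open import Data.Nat.ListAction using (sum)
open import Data.Unit using (⊤)
open import Data.List.Relation.Unary.Unique.Propositional using (Unique)
open import Data.Product using (Σ; ∃; _×_; _,_)
open import Data.Sum using (_⊎_)
open import Relation.Binary.PropositionalEquality using (_≡_)
open import Relation.Nullary using (¬_)

data Walk {V : Set} (R : V → V → Set) : V → V → ℕ → Set where
  nil  : ∀ {x} → Walk R x x 0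
  cons : ∀ {x y z k} → R x y → Walk R y z k → Walk R x z (suc k)

Dist : {V : Set} (R : V → V → Set) → V → V → ℕ → Set
Dist R x y d = Walk R x y d × (∀ k → Walk R x y k → d ≤ k)

record SimpleGraph (n : ℕ) : Set where
  field
    adj    : Fin n → Fin n → Bool
    sym    : ∀ u v → adj u v ≡ adj v u
    irrefl : ∀ v → adj v v ≡ false

module _ {n : ℕ} (T : SimpleGraph n) where
  open SimpleGraph T

  E : Fin n → Fin n → Set
  E u v = adj u v ≡ true

  deg : Fin n → ℕ
  deg v = sum (map (λ u → if adj v u then 1 else 0) (allFin n))

  Leaf : Fin n → Set
  Leaf v = deg v ≡ 1

  Chain : List (Fin n) → Set
  Chain []           = ⊤
  Chain (_ ∷ [])     = ⊤
  Chain (u ∷ v ∷ vs) = E u v × Chain (v ∷ vs)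

  HasCycle : Set
  HasCycle = Σ (Fin n) λ v → Σ (List (Fin n)) λ rest →
    (2 ≤ length rest) × Unique (v ∷ rest) × Chain (v ∷ rest ++ v ∷ [])

  Connected : Set
  Connected = ∀ u v → ∃ λ k → Walk E u v k

  IsTree : Set
  IsTree = Connected × ¬ HasCycle

  -- proper 2-colouring: true = black, false = red
  Proper : (Fin n → Bool) → Set
  Proper col = ∀ u v → E u v → ¬ (col u ≡ col v)

data AV (n : ℕ) : Set where
  orig      : Fin n → AV n            -- red internal vertex, unchanged
  port      : Fin n → Fin n → AV n    -- v_i of black internal v, towards neighbour u
  nV sV     : Fin n → AV n
  wV pV qV  : Fin n → AV n
  cV xV     : Fin n → ℕ → AV n

module AltPath {n : ℕ} (T : SimpleGraph n) (col : Fin n → Bool) (k : Fin n → ℕ) where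

  Black Red Internal : Fin n → Set
  Black v = col v ≡ true
  Red v = col v ≡ false
  Internal v = ¬ Leaf T v

  Valid : AV n → Set
  Valid (orig v)   = Red v × Internal v
  Valid (port v u) = Black v × Internal v × E T v u
  Valid (nV v)     = Black v × Internal v
  Valid (sV v)     = Black v × Internal v
  Valid (wV l)     = Leaf T l
  Valid (pV l)     = Black l × Leaf T l
  Valid (qV l)     = Black l × Leaf T l
  Valid (cV l i)   = Leaf T l × 1 ≤ i × i ≤ k l
  Valid (xV l i)   = Leaf T l × 1 ≤ i × i ≤ k l

  -- attachment vertex of a's gadget for the tree edge ab
  data Att (a b : Fin n) : AV n → Set where
    att-red   : Red a → Internal a → Att a b (orig a)
    att-black : Black a → Internal a → Att a b (port a b)
    att-leaf  : Leaf T a → Att a b (wV a)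

  data Edge : AV n → AV n → Set where
    tree   : ∀ {a b s t} → E T a b → Att a b s → Att b a t → Edge s t
    n-port : ∀ {v u} → Black v → Internal v → E T v u → Edge (nV v) (port v u)
    s-port : ∀ {v u} → Black v → Internal v → E T v u → Edge (sV v) (port v u)
    bl-wp  : ∀ {l} → Black l → Leaf T l → Edge (wV l) (pV l)
    bl-wq  : ∀ {l} → Black l → Leaf T l → Edge (wV l) (qV l)
    bl-pq  : ∀ {l} → Black l → Leaf T l → Edge (pV l) (qV l)
    bl-pc  : ∀ {l} → Black l → Leaf T l → Edge (pV l) (cV l 1)
    bl-cq  : ∀ {l} → Black l → Leaf T l → Edge (cV l (k l)) (qV l)
    rl-wc  : ∀ {l} → Red l → Leaf T l → Edge (wV l) (cV l 1)
    rl-cw  : ∀ {l} → Red l → Leaf T l → Edge (cV l (k l)) (wV l)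
    cc     : ∀ {l i} → Leaf T l → 1 ≤ i → suc i ≤ k l → Edge (cV l i) (cV l (suc i))
    cx     : ∀ {l i} → Leaf T l → 1 ≤ i → i ≤ k l → Edge (cV l i) (xV l i)

  Vertex : Set
  Vertex = Σ (AV n) Valid

  Adj : Vertex → Vertex → Set
  Adj (a , _) (b , _) = Edge a b ⊎ Edge b a

{-# OPTIONS --safe #-}
-- Swapping the colours turns every black gadget into a red one and vice versa, and a
-- walk in one structure can be shadowed by a walk in the other that is never longer:
-- a red internal vertex v is shadowed by n_v, the vertices n_v, s_v of a black gadget by
-- the unchanged v, a port v_i (and the vertex w of a black leaf) by the attachment vertex
-- on the other side of its tree edge, p and q by w, and c_i, x_i by themselves.  The only
-- place where the shadow falls behind is the vertex w of a red leaf, which lies on the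
-- k-cycle; it is shadowed by c_1, c_k or w together with one step of credit, and since
-- k ≤ 3 the detours c_1 ⇝ c_k and w ⇝ p ⇝ c_1 in the black gadget cost at most the
-- step plus that credit.  Applying this to both colourings shows that the distances
-- between degree-1 vertices agree.
module Submission where

open import Defs
open import Data.Nat using (ℕ; zero; suc; _≤_; _+_; _∸_; z≤n; s≤s; _≟_)
open import Data.Nat.Properties
open import Data.Fin using (Fin; zero; suc)
open import Data.Bool using (Bool; not; true; false; if_then_else_)
open import Data.Bool.Properties using (not-involutive; not-injective; ¬-not)
open import Data.Product using (Σ; ∃; _×_; _,_; proj₁; proj₂)
open import Data.Sum using (_⊎_; inj₁; inj₂; swap)
open import Data.Empty using (⊥; ⊥-elim)
open import Data.List using (tabulate)
open import Data.List.Properties using (map-tabulate)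
open import Data.Nat.ListAction using (sum)
open import Function using (_∘_; _⇔_; id)
open import Function.Bundles using (mk⇔)
open import Relation.Binary.PropositionalEquality
  using (_≡_; _≢_; refl; sym; trans; cong; cong₂; subst; subst₂)
open import Relation.Nullary using (¬_; yes; no)

module _ {V : Set} {R : V → V → Set} where

  _∷ʳ_ : ∀ {x y z m} → Walk R x y m → R y z → Walk R x z (suc m)
  nil      ∷ʳ e′ = cons e′ nil
  cons e w ∷ʳ e′ = cons e (w ∷ʳ e′)

  reverse : (∀ {x y} → R x y → R y x) → ∀ {x y m} → Walk R x y m → Walk R y x m
  reverse R-sym nil        = nil
  reverse R-sym (cons e w) = reverse R-sym w ∷ʳ R-sym e

  _++_ : ∀ {x y z m m′} → Walk R x y m → Walk R y z m′ → Walk R x z (m + m′)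
  nil      ++ w′ = w′
  cons e w ++ w′ = cons e (w ++ w′)

ShortensInto : {V₁ V₂ : Set} → (V₁ → V₁ → Set) → V₁ → V₁ →
               (V₂ → V₂ → Set) → V₂ → V₂ → Set
ShortensInto R₁ x₁ y₁ R₂ x₂ y₂ =
  ∀ {m} → Walk R₁ x₁ y₁ m → ∃ λ h → h ≤ m × Walk R₂ x₂ y₂ h

Dist-transfer : ∀ {V₁ V₂ : Set} {R₁ : V₁ → V₁ → Set} {R₂ : V₂ → V₂ → Set}
  {x₁ y₁ : V₁} {x₂ y₂ : V₂} {d : ℕ} →
  ShortensInto R₁ x₁ y₁ R₂ x₂ y₂ → ShortensInto R₂ x₂ y₂ R₁ x₁ y₁ →
  Dist R₁ x₁ y₁ d → Dist R₂ x₂ y₂ d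
Dist-transfer {R₂ = R₂} {x₂ = x₂} {y₂ = y₂} to from (w , shortest)
  with to w
... | h , h≤d , w′ with from w′
...   | h′ , h′≤h , w″ =
  subst (Walk R₂ x₂ y₂) (≤-antisym h≤d (≤-trans (shortest h′ w″) h′≤h)) w′ ,
  λ m wₘ → let (h″ , h″≤m , w‴) = from wₘ in ≤-trans (shortest h″ w‴) h″≤m

f≤sum-tabulate : ∀ {m} (f : Fin m → ℕ) u → f u ≤ sum (tabulate f)
f≤sum-tabulate f zero    = m≤m+n (f zero) _
f≤sum-tabulate f (suc u) = ≤-trans (f≤sum-tabulate (f ∘ suc) u) (m≤n+m _ (f zero))

f+f≤sum-tabulate : ∀ {m} (f : Fin m → ℕ) {u u′} → u ≢ u′ → f u + f u′ ≤ sum (tabulate f)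
f+f≤sum-tabulate f {zero}  {zero}    u≢u′ = ⊥-elim (u≢u′ refl)
f+f≤sum-tabulate f {zero}  {suc u′}  u≢u′ = +-monoʳ-≤ (f zero) (f≤sum-tabulate (f ∘ suc) u′)
f+f≤sum-tabulate f {suc u} {zero}    u≢u′ =
  subst (_≤ sum (tabulate f)) (+-comm (f zero) (f (suc u)))
        (+-monoʳ-≤ (f zero) (f≤sum-tabulate (f ∘ suc) u))
f+f≤sum-tabulate f {suc u} {suc u′} u≢u′ =
  ≤-trans (f+f≤sum-tabulate (f ∘ suc) (u≢u′ ∘ cong suc)) (m≤n+m _ (f zero))

sum-tabulate≢0 : ∀ {m} (f : Fin m → ℕ) → sum (tabulate f) ≢ 0 → ∃ λ u → f u ≢ 0
sum-tabulate≢0 {zero}  f s≢0 = ⊥-elim (s≢0 refl)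
sum-tabulate≢0 {suc m} f s≢0 with f zero ≟ 0
... | no f₀≢0  = zero , f₀≢0
... | yes f₀≡0 =
  let (u , fu≢0) = sum-tabulate≢0 (f ∘ suc) (λ s≡0 → s≢0 (cong₂ _+_ f₀≡0 s≡0)) in suc u , fu≢0

module _ {n : ℕ} (T : SimpleGraph n) where
  open SimpleGraph T using (adj)

  E-sym : ∀ {u v} → E T u v → E T v u
  E-sym {u} {v} e = trans (SimpleGraph.sym T v u) e

  private
    indicator : Fin n → Fin n → ℕ
    indicator v u = if adj v u then 1 else 0

    deg≡sum-indicator : ∀ v → deg T v ≡ sum (tabulate (indicator v))
    deg≡sum-indicator v = cong sum (map-tabulate id (indicator v))

    E⇒indicator≡1 : ∀ {v u} → E T v u → indicator v u ≡ 1
    E⇒indicator≡1 e rewrite e = refl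

    indicator≢0⇒E : ∀ v u → indicator v u ≢ 0 → E T v u
    indicator≢0⇒E v u ι≢0 with adj v u
    ... | true  = refl
    ... | false = ⊥-elim (ι≢0 refl)

  leaf-neighbour : ∀ {l} → Leaf T l → ∃ λ u → E T l u
  leaf-neighbour {l} leaf =
    let (u , ι≢0) = sum-tabulate≢0 (indicator l)
                      (subst (_≢ 0) (trans (sym leaf) (deg≡sum-indicator l)) λ ())
    in u , indicator≢0⇒E l u ι≢0

  leaf-neighbour-unique : ∀ {l u u′} → Leaf T l → E T l u → E T l u′ → u ≡ u′
  leaf-neighbour-unique {l} {u} {u′} leaf e e′ with u Data.Fin.≟ u′
  ... | yes u≡u′ = u≡u′
  ... | no  u≢u′ = ⊥-elim (1+n≰n {1} (begin
      2                                  ≡⟨ sym (cong₂ _+_ (E⇒indicator≡1 e) (E⇒indicator≡1 e′)) ⟩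
      indicator l u + indicator l u′     ≤⟨ f+f≤sum-tabulate (indicator l) u≢u′ ⟩
      sum (tabulate (indicator l))       ≡⟨ trans (sym (deg≡sum-indicator l)) leaf ⟩
      1                                  ∎))
    where open ≤-Reasoning

  Proper⇒flip : ∀ {c} → Proper T c → ∀ {u v} → E T u v → c v ≡ not (c u)
  Proper⇒flip proper {u} {v} e = ¬-not (λ cv≡cu → proper u v e (sym cv≡cu))

  Proper-not : ∀ {c} → Proper T c → Proper T (not ∘ c)
  Proper-not proper u v e = proper u v e ∘ not-injective

  gadget-index-irrelevant : ∀ (k : Fin n → ℕ) {l i} (p q : Leaf T l × 1 ≤ i × i ≤ k l) → p ≡ q
  gadget-index-irrelevant k (leaf , 1≤i , i≤k) (leaf′ , 1≤i′ , i≤k′)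
    rewrite ≡-irrelevant leaf leaf′ | ≤-irrelevant 1≤i 1≤i′ | ≤-irrelevant i≤k i≤k′ = refl

module Shadowing {n : ℕ} (T : SimpleGraph n) (c c′ : Fin n → Bool)
  (c′≡not-c : ∀ v → c′ v ≡ not (c v)) (proper : Proper T c)
  (k : Fin n → ℕ) (k-bounds : ∀ l → Leaf T l → 1 ≤ k l × k l ≤ 3) where

  module G = AltPath T c k
  module H = AltPath T c′ k

  private
    true≢false : ∀ {b} → b ≡ true → b ≡ false → ⊥
    true≢false refl ()

  red⇒black′ : ∀ {v} → G.Red v → H.Black v
  red⇒black′ {v} red = trans (c′≡not-c v) (cong not red)

  black⇒red′ : ∀ {v} → G.Black v → H.Red v
  black⇒red′ {v} black = trans (c′≡not-c v) (cong not black)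

  red-neighbour : ∀ {u v} → E T u v → G.Red u → G.Black v
  red-neighbour e red = trans (Proper⇒flip T proper e) (cong not red)

  black-neighbour : ∀ {u v} → E T u v → G.Black u → G.Red v
  black-neighbour e black = trans (Proper⇒flip T proper e) (cong not black)

  c-path : ∀ {l} → Leaf T l → ∀ m {i j} → m + i ≡ j → 1 ≤ i → j ≤ k l →
           (p : H.Valid (cV l i)) (q : H.Valid (cV l j)) → Walk H.Adj (cV l i , p) (cV l j , q) m
  c-path {l} leaf zero {i} refl _ _ p q =
    subst (λ q → Walk H.Adj (cV l i , p) (cV l i , q) 0) (gadget-index-irrelevant T k p q) nil
  c-path {l} leaf (suc m) {i} m+1+i≡j 1≤i j≤k p q =
    cons (inj₁ (H.cc leaf 1≤i 1+i≤k))
         (c-path leaf m (trans (+-suc m i) m+1+i≡j) (s≤s z≤n) j≤k (leaf , s≤s z≤n , 1+i≤k) q)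
    where
    1+i≤k : suc i ≤ k l
    1+i≤k = ≤-trans (s≤s (m≤n+m i m)) (subst (_≤ k l) (sym m+1+i≡j) j≤k)

  c₁⇝cₖ : ∀ {l} (leaf : Leaf T l) p q → Walk H.Adj (cV l 1 , p) (cV l (k l) , q) (k l ∸ 1)
  c₁⇝cₖ {l} leaf = c-path leaf (k l ∸ 1) (m∸n+n≡m 1≤k) (s≤s z≤n) ≤-refl
    where 1≤k = proj₁ (k-bounds l leaf)

  k∸1≤2 : ∀ {l} → Leaf T l → k l ∸ 1 + 0 ≤ 2
  k∸1≤2 {l} leaf = subst (_≤ 2) (sym (+-identityʳ (k l ∸ 1))) (∸-monoˡ-≤ 1 (proj₂ (k-bounds l leaf)))

  -- Shadow a B r: the vertex B of H stands in for the vertex a of G, with r steps of credit.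
  data Shadow : AV n → H.Vertex → ℕ → Set where
    at-orig    : ∀ {v p} → Shadow (orig v) (nV v , p) 0
    at-port    : ∀ {v u t p} → E T v u → H.Att u v t → Shadow (port v u) (t , p) 0
    at-n       : ∀ {v p} → Shadow (nV v) (orig v , p) 0
    at-s       : ∀ {v p} → Shadow (sV v) (orig v , p) 0
    at-black-w : ∀ {l u t p} → G.Black l → E T l u → H.Att u l t → Shadow (wV l) (t , p) 0
    at-p       : ∀ {l p} → Shadow (pV l) (wV l , p) 0
    at-q       : ∀ {l p} → Shadow (qV l) (wV l , p) 0
    at-red-w₁  : ∀ {l p} → G.Red l → Shadow (wV l) (cV l 1 , p) 1
    at-red-wₖ  : ∀ {l p} → G.Red l → Shadow (wV l) (cV l (k l) , p) 1
    at-red-w   : ∀ {l p} → G.Red l → Shadow (wV l) (wV l , p) 1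
    at-c       : ∀ {l i p} → Shadow (cV l i) (cV l i , p) 0
    at-x       : ∀ {l i p} → Shadow (xV l i) (xV l i , p) 0

  record Follows (a : AV n) (B : H.Vertex) (budget : ℕ) : Set where
    constructor follows
    field
      {target}       : H.Vertex
      {credit}       : ℕ
      {length}       : ℕ
      shadow         : Shadow a target credit
      walk           : Walk H.Adj B target length
      within-budget  : length + credit ≤ budget

  forth : ∀ {a b pa} → H.Edge a b → (pb : H.Valid b) → Walk H.Adj (a , pa) (b , pb) 1
  forth e _ = cons (inj₁ e) nil

  back : ∀ {a b pa} → H.Edge b a → (pb : H.Valid b) → Walk H.Adj (a , pa) (b , pb) 1
  back e _ = cons (inj₂ e) nil

  module _ {l} (black : H.Black l) (leaf : Leaf T l) where

    w⇝c₁ : ∀ {p q} → Walk H.Adj (wV l , p) (cV l 1 , q) 2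
    w⇝c₁ = cons {y = pV l , (black , leaf)} (inj₁ (H.bl-wp black leaf)) (forth (H.bl-pc black leaf) _)

    w⇝cₖ : ∀ {p q} → Walk H.Adj (wV l , p) (cV l (k l) , q) 2
    w⇝cₖ = cons {y = qV l , (black , leaf)} (inj₁ (H.bl-wq black leaf)) (back (H.bl-cq black leaf) _)

  H-attachment-of-red : ∀ {u v} → E T u v → G.Red u → Σ (AV n) λ t → H.Att u v t × H.Valid t
  H-attachment-of-red {u} {v} e red with deg T u ≟ 1
  ... | yes leaf     = wV u , H.att-leaf leaf , leaf
  ... | no  internal =
    port u v , H.att-black (red⇒black′ red) internal , (red⇒black′ red , internal , e)

  step-to-port : ∀ {v u p} → G.Black v → G.Internal v → E T v u →
                 Follows (port v u) (orig v , p) 1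
  step-to-port bv iv e =
    let (t , att , vt) = H-attachment-of-red (E-sym T e) (black-neighbour e bv) in
    follows (at-port e att) (forth (H.tree e (H.att-red (black⇒red′ bv) iv) att) vt) ≤-refl

  step-to-black-w : ∀ {l p} → G.Black l → Leaf T l → Follows (wV l) (wV l , p) 1
  step-to-black-w bl ll =
    let (u , e) = leaf-neighbour T ll
        (t , att , vt) = H-attachment-of-red (E-sym T e) (black-neighbour e bl) in
    follows (at-black-w bl e att) (forth (H.tree e (H.att-leaf ll) att) vt) ≤-refl

  tree-step-from-black : ∀ {x y t B pB} → G.Black x → E T x y → H.Att y x B → G.Att y x t →
                         Follows t (B , pB) 1
  tree-step-from-black bx e (H.att-black by′ iy′) (G.att-red ry iy) =
    follows at-orig (back (H.n-port by′ iy′ (E-sym T e)) (red⇒black′ ry , iy)) ≤-refl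
  tree-step-from-black bx e (H.att-leaf _) (G.att-leaf _) = follows (at-red-w (black-neighbour e bx)) nil ≤-refl
  tree-step-from-black bx e (H.att-red ry′ _) (G.att-red ry _) = ⊥-elim (true≢false (red⇒black′ ry) ry′)
  tree-step-from-black bx e _ (G.att-black by _)               = ⊥-elim (true≢false by (black-neighbour e bx))
  tree-step-from-black bx e (H.att-leaf ly) (G.att-red _ iy)   = ⊥-elim (iy ly)
  tree-step-from-black bx e (H.att-red _ iy) (G.att-leaf ly)   = ⊥-elim (iy ly)
  tree-step-from-black bx e (H.att-black _ iy) (G.att-leaf ly) = ⊥-elim (iy ly)

  tree-step-from-red-leaf : ∀ {x y t B h} → G.Red x → (lx : Leaf T x) → E T x y → G.Att y x t →
                            Walk H.Adj B (wV x , lx) h → h + 0 ≤ 2 → Follows t B 2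
  tree-step-from-red-leaf rx lx e (G.att-red ry _) _ _ = ⊥-elim (true≢false (red-neighbour e rx) ry)
  tree-step-from-red-leaf rx lx e (G.att-black _ _) w h≤2 =
    follows (at-port (E-sym T e) (H.att-leaf lx)) w h≤2
  tree-step-from-red-leaf rx lx e (G.att-leaf _) w h≤2 =
    follows (at-black-w (red-neighbour e rx) (E-sym T e) (H.att-leaf lx)) w h≤2

  tree-step : ∀ {x y s t B r} → E T x y → G.Att x y s → G.Att y x t →
              Shadow s B r → Follows t B (suc r)
  tree-step e (G.att-red rx _) (G.att-red ry _) at-orig = ⊥-elim (true≢false (red-neighbour e rx) ry)
  tree-step e (G.att-red rx ix) (G.att-black _ _) at-orig =
    follows (at-port (E-sym T e) (H.att-black (red⇒black′ rx) ix))
            (forth (H.n-port (red⇒black′ rx) ix e) (red⇒black′ rx , ix , e)) ≤-refl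
  tree-step e (G.att-red rx ix) (G.att-leaf _) at-orig =
    follows (at-black-w (red-neighbour e rx) (E-sym T e) (H.att-black (red⇒black′ rx) ix))
            (forth (H.n-port (red⇒black′ rx) ix e) (red⇒black′ rx , ix , e)) ≤-refl
  tree-step e (G.att-black bx _) at (at-port _ att) = tree-step-from-black bx e att at
  tree-step {x} e (G.att-leaf lx) at (at-black-w bx e′ att) =
    tree-step-from-black bx e (subst (λ u → H.Att u x _) (leaf-neighbour-unique T lx e′ e) att) at
  tree-step e (G.att-leaf lx) at (at-red-w₁ rx) =
    tree-step-from-red-leaf rx lx e at (reverse swap (w⇝c₁ (red⇒black′ rx) lx)) ≤-refl
  tree-step e (G.att-leaf lx) at (at-red-wₖ rx) =
    tree-step-from-red-leaf rx lx e at (reverse swap (w⇝cₖ (red⇒black′ rx) lx)) ≤-refl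
  tree-step {x} e (G.att-leaf lx) at (at-red-w {p = p} rx) =
    tree-step-from-red-leaf rx lx e at
      (subst (λ q → Walk H.Adj (wV x , p) (wV x , q) 0) (≡-irrelevant p lx) nil) z≤n

  step-forward : ∀ {a a′ B r} → G.Valid a′ → G.Edge a a′ → Shadow a B r → Follows a′ B (suc r)
  step-forward _ (G.tree e as at) sh                = tree-step e as at sh
  step-forward _ (G.n-port bv iv e) at-n            = step-to-port bv iv e
  step-forward _ (G.s-port bv iv e) at-s            = step-to-port bv iv e
  step-forward _ (G.bl-wp _ ll) (at-black-w _ e att) = follows at-p (back (H.tree e (H.att-leaf ll) att) ll) ≤-refl
  step-forward _ (G.bl-wp bl _) (at-red-w₁ rl)      = ⊥-elim (true≢false bl rl)
  step-forward _ (G.bl-wp bl _) (at-red-wₖ rl)      = ⊥-elim (true≢false bl rl)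
  step-forward _ (G.bl-wp bl _) (at-red-w rl)       = ⊥-elim (true≢false bl rl)
  step-forward _ (G.bl-wq _ ll) (at-black-w _ e att) = follows at-q (back (H.tree e (H.att-leaf ll) att) ll) ≤-refl
  step-forward _ (G.bl-wq bl _) (at-red-w₁ rl)      = ⊥-elim (true≢false bl rl)
  step-forward _ (G.bl-wq bl _) (at-red-wₖ rl)      = ⊥-elim (true≢false bl rl)
  step-forward _ (G.bl-wq bl _) (at-red-w rl)       = ⊥-elim (true≢false bl rl)
  step-forward _ (G.bl-pq _ _) at-p                 = follows at-q nil z≤n
  step-forward v (G.bl-pc bl ll) at-p               = follows at-c (forth (H.rl-wc (black⇒red′ bl) ll) v) ≤-refl
  step-forward _ (G.bl-cq bl ll) at-c               = follows at-q (forth (H.rl-cw (black⇒red′ bl) ll) ll) ≤-refl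
  step-forward _ (G.rl-wc rl _) (at-black-w bl _ _) = ⊥-elim (true≢false bl rl)
  step-forward _ (G.rl-wc _ _) (at-red-w₁ _)        = follows at-c nil z≤n
  step-forward v (G.rl-wc _ ll) (at-red-wₖ {p = p} _) = follows at-c (reverse swap (c₁⇝cₖ ll v p)) (k∸1≤2 ll)
  step-forward v (G.rl-wc rl ll) (at-red-w _)       = follows at-c (w⇝c₁ (red⇒black′ rl) ll {q = v}) ≤-refl
  step-forward _ (G.rl-cw rl _) at-c                = follows (at-red-wₖ rl) nil ≤-refl
  step-forward v (G.cc ll 1≤i 1+i≤k) at-c           = follows at-c (forth (H.cc ll 1≤i 1+i≤k) v) ≤-refl
  step-forward v (G.cx ll 1≤i i≤k) at-c             = follows at-x (forth (H.cx ll 1≤i i≤k) v) ≤-refl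

  step-backward : ∀ {a a′ B r} → G.Valid a′ → G.Edge a′ a → Shadow a B r → Follows a′ B (suc r)
  step-backward _ (G.tree e as at) sh               = tree-step (E-sym T e) at as sh
  step-backward _ (G.n-port bv iv e) (at-port _ att) =
    follows at-n (back (H.tree e (H.att-red (black⇒red′ bv) iv) att) (black⇒red′ bv , iv)) ≤-refl
  step-backward _ (G.s-port bv iv e) (at-port _ att) =
    follows at-s (back (H.tree e (H.att-red (black⇒red′ bv) iv) att) (black⇒red′ bv , iv)) ≤-refl
  step-backward _ (G.bl-wp bl ll) at-p              = step-to-black-w bl ll
  step-backward _ (G.bl-wq bl ll) at-q              = step-to-black-w bl ll
  step-backward _ (G.bl-pq _ _) at-q                = follows at-p nil z≤n
  step-backward _ (G.bl-pc bl ll) at-c              = follows at-p (back (H.rl-wc (black⇒red′ bl) ll) ll) ≤-refl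
  step-backward v (G.bl-cq bl ll) at-q              = follows at-c (back (H.rl-cw (black⇒red′ bl) ll) v) ≤-refl
  step-backward _ (G.rl-wc rl _) at-c               = follows (at-red-w₁ rl) nil ≤-refl
  step-backward _ (G.rl-cw rl _) (at-black-w bl _ _) = ⊥-elim (true≢false bl rl)
  step-backward v (G.rl-cw _ ll) (at-red-w₁ {p = p} _) = follows at-c (c₁⇝cₖ ll p v) (k∸1≤2 ll)
  step-backward _ (G.rl-cw _ _) (at-red-wₖ _)       = follows at-c nil z≤n
  step-backward v (G.rl-cw rl ll) (at-red-w _)      = follows at-c (w⇝cₖ (red⇒black′ rl) ll {q = v}) ≤-refl
  step-backward v (G.cc ll 1≤i 1+i≤k) at-c          = follows at-c (back (H.cc ll 1≤i 1+i≤k) v) ≤-refl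
  step-backward v (G.cx ll 1≤i i≤k) at-x            = follows at-c (back (H.cx ll 1≤i i≤k) v) ≤-refl

  step : ∀ {x y B r} → G.Adj x y → Shadow (proj₁ x) B r → Follows (proj₁ y) B (suc r)
  step {y = _ , v} (inj₁ e) = step-forward v e
  step {y = _ , v} (inj₂ e) = step-backward v e

  budget-++ : ∀ {h₁ h₂ r r₁ r₂ m} → h₁ + r₁ ≤ suc r → h₂ + r₂ ≤ m + r₁ → h₁ + h₂ + r₂ ≤ suc m + r
  budget-++ {h₁} {h₂} {r} {r₁} {r₂} {m} b₁ b₂ = begin
    h₁ + h₂ + r₂    ≡⟨ +-assoc h₁ h₂ r₂ ⟩
    h₁ + (h₂ + r₂)  ≤⟨ +-monoʳ-≤ h₁ b₂ ⟩
    h₁ + (m + r₁)   ≡⟨ +-comm h₁ (m + r₁) ⟩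
    m + r₁ + h₁     ≡⟨ +-assoc m r₁ h₁ ⟩
    m + (r₁ + h₁)   ≡⟨ cong (m +_) (+-comm r₁ h₁) ⟩
    m + (h₁ + r₁)   ≤⟨ +-monoʳ-≤ m b₁ ⟩
    m + suc r       ≡⟨ +-suc m r ⟩
    suc m + r       ∎
    where open ≤-Reasoning

  follow-walk : ∀ {x z m} → Walk G.Adj x z m →
                ∀ {B r} → Shadow (proj₁ x) B r → Follows (proj₁ z) B (m + r)
  follow-walk nil sh = follows sh nil ≤-refl
  follow-walk {x} (cons {y = y} e w) sh with step {x} {y} e sh
  ... | follows sh₁ w₁ b₁ with follow-walk w sh₁
  ...   | follows sh₂ w₂ b₂ = follows sh₂ (w₁ ++ w₂) (budget-++ b₁ b₂)

  shortens : ∀ {l i l′ i′} (p : G.Valid (xV l i)) (q : G.Valid (xV l′ i′)) →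
             ShortensInto G.Adj (xV l i , p) (xV l′ i′ , q) H.Adj (xV l i , p) (xV l′ i′ , q)
  shortens p q {m} w with follow-walk w (at-x {p = p})
  ... | follows {length = h} (at-x {p = q′}) w′ h+0≤m+0 =
    h , subst₂ _≤_ (+-identityʳ h) (+-identityʳ m) h+0≤m+0 ,
    subst (λ q → Walk H.Adj _ (_ , q) h) (gadget-index-irrelevant T k q′ q) w′

lemma8 : ∀ {n} (T : SimpleGraph n) → IsTree T
    → (∀ v → ¬ Leaf T v → deg T v ≡ 3)
    → (Σ (Fin n) λ l₁ → Σ (Fin n) λ l₂ → l₁ ≢ l₂ × Leaf T l₁ × Leaf T l₂)
    → (col : Fin n → Bool) → Proper T col
    → (k : Fin n → ℕ) → (∀ l → Leaf T l → k l ≡ 2 ⊎ k l ≡ 3)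
    → ∀ l l' i i' (hl : Leaf T l) (hl' : Leaf T l')
      (hi : 1 ≤ i × i ≤ k l) (hi' : 1 ≤ i' × i' ≤ k l') (d : ℕ)
    → Dist (AltPath.Adj T col k) (xV l i , hl , hi) (xV l' i' , hl' , hi') d
      ⇔ Dist (AltPath.Adj T (not ∘ col) k) (xV l i , hl , hi) (xV l' i' , hl' , hi') d
lemma8 T _ _ _ col proper k k∈2,3 l l' i i' hl hl' hi hi' d =
  mk⇔ (Dist-transfer (Swap.shortens (hl , hi) (hl' , hi')) (Unswap.shortens (hl , hi) (hl' , hi')))
      (Dist-transfer (Unswap.shortens (hl , hi) (hl' , hi')) (Swap.shortens (hl , hi) (hl' , hi')))
  where
  k-bounds : ∀ l₀ → Leaf T l₀ → 1 ≤ k l₀ × k l₀ ≤ 3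
  k-bounds l₀ leaf with k l₀ | k∈2,3 l₀ leaf
  ... | _ | inj₁ refl = s≤s z≤n , s≤s (s≤s z≤n)
  ... | _ | inj₂ refl = s≤s z≤n , ≤-refl

  module Swap   = Shadowing T col (not ∘ col) (λ _ → refl) proper k k-bounds
  module Unswap = Shadowing T (not ∘ col) col (sym ∘ not-involutive ∘ col) (Proper-not T proper) k k-bounds
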